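{- For every graph $G$ and every 2-switch $\tau$ on $G$, $|\nu(\tau(G))-\nu(G)|\le 1$, where $\nu$ denotes the vertex-covering number.
   Context: Graphs are finite and simple. A 2-switch on $G$ is specified by four distinct vertices $a,b,c,d$ with $ab,cd\in E(G)$ and $ac,bd\notin E(G)$; it produces $\tau(G)=G-ab-cd+ac+bd$. $\nu(G)$ is the minimum size of a set $U\subseteq V(G)$ such that every edge of $G$ has at least one endpoint in $U$. -}

module Defs where

open import Data.Nat using (ℕ; _≤_)
open import Data.Fin using (Fin; _≟_)
open import Data.Fin.Subset using (Subset; _∈_; ∣_∣)
open import Data.Bool using (Bool; true; false; not; _∧_; _∨_)
open import Data.Product using (_×_; Σ)
open import Data.Sum using (_⊎_)
open import Relation.Nullary using (¬_)
open import Relation.Nullary.Decidable using (⌊_⌋)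
open import Relation.Binary.PropositionalEquality using (_≡_)

record Graph (n : ℕ) : Set where
  field
    adj   : Fin n → Fin n → Bool
    sym   : ∀ u v → adj u v ≡ adj v u
    irrefl : ∀ u → adj u u ≡ false
open Graph public

Edge : ∀ {n} → Graph n → Fin n → Fin n → Set
Edge G u v = adj G u v ≡ true

IsVertexCover : ∀ {n} → Graph n → Subset n → Set
IsVertexCover {n} G U = ∀ (u v : Fin n) → Edge G u v → u ∈ U ⊎ v ∈ U

IsVertexCoverNumber : ∀ {n} → Graph n → ℕ → Set
IsVertexCoverNumber {n} G k =
  (Σ (Subset n) λ U → IsVertexCover G U × ∣ U ∣ ≡ k)
  × (∀ (U : Subset n) → IsVertexCover G U → k ≤ ∣ U ∣)

Is2Switch : ∀ {n} → Graph n → Fin n → Fin n → Fin n → Fin n → Set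
Is2Switch G a b c d =
  ¬ a ≡ b × ¬ a ≡ c × ¬ a ≡ d × ¬ b ≡ c × ¬ b ≡ d × ¬ c ≡ d
  × Edge G a b × Edge G c d × ¬ Edge G a c × ¬ Edge G b d

samePair : ∀ {n} → Fin n → Fin n → Fin n → Fin n → Bool
samePair u v x y =
  (⌊ u ≟ x ⌋ ∧ ⌊ v ≟ y ⌋) ∨ (⌊ u ≟ y ⌋ ∧ ⌊ v ≟ x ⌋)

switchAdj : ∀ {n} → Graph n → Fin n → Fin n → Fin n → Fin n → Fin n → Fin n → Bool
switchAdj G a b c d u v =
  (adj G u v ∧ not (samePair u v a b) ∧ not (samePair u v c d))
  ∨ samePair u v a c ∨ samePair u v b d

{-# OPTIONS --safe #-}
-- A 2-switch exchanges the edges ab, cd of G for ac, bd, and the inverse exchange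
-- turns τ(G) back into G. If every edge of H′ is an edge of H or one of two pairs
-- pr, qs, where pq is an edge of H, then any vertex cover U of H contains p or q,
-- and adding s (respectively r) to U covers H′. Hence ν(H′) ≤ ν(H) + 1, and
-- applying this in both directions gives the theorem.
module Submission where

open import Defs hiding (sym)
open import Data.Bool using (true; not; _∧_; _∨_)
open import Data.Bool.Properties using (T-≡)
open import Data.Fin using (Fin; _≟_)
open import Data.Fin.Subset using (Subset; _∈_; ∣_∣; _∪_; ⁅_⁆; inside; outside)
open import Data.Fin.Subset.Properties using (p⊆p∪q; x∈p∪q⁺; x∈⁅x⁆; ∣⁅x⁆∣≡1; ∣p∣≤∣x∷p∣)
open import Data.Nat using (ℕ; _≤_; _+_; suc; s≤s; z≤n)
open import Data.Nat.Properties using (≤-trans; +-monoʳ-≤; +-comm; +-suc; module ≤-Reasoning)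
open import Data.Product using (_×_; _,_; Σ; proj₁)
open import Data.Sum using (_⊎_; inj₁; inj₂; swap; map₁; map₂)
import Data.Sum as Sum
open import Data.Vec using ([]; _∷_)
open import Function.Bundles using (module Equivalence)
open import Relation.Nullary using (Dec; yes; no; does; ¬_)
open import Relation.Nullary.Decidable using (T?; ¬?; _×-dec_; _⊎-dec_; map′; dec-true; isYes≗does)
open import Relation.Binary.PropositionalEquality using (_≡_; refl; trans; sym; cong; cong₂)

open Equivalence using (to; from)

dec-true⁻ : ∀ {A : Set} (a? : Dec A) → does a? ≡ true → A
dec-true⁻ (yes a) _ = a
dec-true⁻ (no _) ()

∣p∪q∣≤∣p∣+∣q∣ : ∀ {n} (p q : Subset n) → ∣ p ∪ q ∣ ≤ ∣ p ∣ + ∣ q ∣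
∣p∪q∣≤∣p∣+∣q∣ []            []            = z≤n
∣p∪q∣≤∣p∣+∣q∣ (inside  ∷ p) (t       ∷ q) =
  s≤s (≤-trans (∣p∪q∣≤∣p∣+∣q∣ p q) (+-monoʳ-≤ ∣ p ∣ (∣p∣≤∣x∷p∣ t q)))
∣p∪q∣≤∣p∣+∣q∣ (outside ∷ p) (inside  ∷ q) rewrite +-suc ∣ p ∣ ∣ q ∣ = s≤s (∣p∪q∣≤∣p∣+∣q∣ p q)
∣p∪q∣≤∣p∣+∣q∣ (outside ∷ p) (outside ∷ q) = ∣p∪q∣≤∣p∣+∣q∣ p q

∣p∪⁅x⁆∣≤1+∣p∣ : ∀ {n} (p : Subset n) (x : Fin n) → ∣ p ∪ ⁅ x ⁆ ∣ ≤ suc ∣ p ∣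
∣p∪⁅x⁆∣≤1+∣p∣ p x = begin
  ∣ p ∪ ⁅ x ⁆ ∣      ≤⟨ ∣p∪q∣≤∣p∣+∣q∣ p ⁅ x ⁆ ⟩
  ∣ p ∣ + ∣ ⁅ x ⁆ ∣  ≡⟨ cong (∣ p ∣ +_) (∣⁅x⁆∣≡1 x) ⟩
  ∣ p ∣ + 1          ≡⟨ +-comm ∣ p ∣ 1 ⟩
  suc ∣ p ∣          ∎
  where open ≤-Reasoning

SamePair : ∀ {n} → Fin n → Fin n → Fin n → Fin n → Set
SamePair u v x y = (u ≡ x × v ≡ y) ⊎ (u ≡ y × v ≡ x)

samePair? : ∀ {n} (u v x y : Fin n) → Dec (SamePair u v x y)
samePair? u v x y = (u ≟ x ×-dec v ≟ y) ⊎-dec (u ≟ y ×-dec v ≟ x)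

samePair≡does : ∀ {n} (u v x y : Fin n) → samePair u v x y ≡ does (samePair? u v x y)
samePair≡does u v x y =
  cong₂ _∨_ (cong₂ _∧_ (isYes≗does (u ≟ x)) (isYes≗does (v ≟ y)))
            (cong₂ _∧_ (isYes≗does (u ≟ y)) (isYes≗does (v ≟ x)))

edge? : ∀ {n} (G : Graph n) (u v : Fin n) → Dec (Edge G u v)
edge? G u v = map′ (to T-≡) (from T-≡) (T? (adj G u v))

SwitchEdge : ∀ {n} → Graph n → (a b c d u v : Fin n) → Set
SwitchEdge G a b c d u v =
  Edge G u v × ¬ SamePair u v a b × ¬ SamePair u v c d ⊎ SamePair u v a c ⊎ SamePair u v b d

switchEdge? : ∀ {n} (G : Graph n) (a b c d u v : Fin n) → Dec (SwitchEdge G a b c d u v)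
switchEdge? G a b c d u v =
  edge? G u v ×-dec ¬? (samePair? u v a b) ×-dec ¬? (samePair? u v c d)
  ⊎-dec samePair? u v a c ⊎-dec samePair? u v b d

switchAdj≡does : ∀ {n} (G : Graph n) (a b c d u v : Fin n)
  → switchAdj G a b c d u v ≡ does (switchEdge? G a b c d u v)
switchAdj≡does G a b c d u v =
  cong₂ _∨_
    (cong₂ (λ ab cd → adj G u v ∧ not ab ∧ not cd) (samePair≡does u v a b) (samePair≡does u v c d))
    (cong₂ _∨_ (samePair≡does u v a c) (samePair≡does u v b d))

-- E(H′) ⊆ E(H) ∪ {pr, qs}; a record so that its indices can be inferred.
record EdgesWithin {n} (H′ H : Graph n) (p r q s : Fin n) : Set where
  constructor edgesWithin
  field
    classify : ∀ (u v : Fin n) → Edge H′ u v → Edge H u v ⊎ SamePair u v p r ⊎ SamePair u v q s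
open EdgesWithin

EdgesWithin-swap : ∀ {n} {H′ H : Graph n} {p r q s : Fin n}
  → EdgesWithin H′ H p r q s → EdgesWithin H′ H q s p r
EdgesWithin-swap within = edgesWithin λ u v e → map₂ swap (classify within u v e)

cover-∪⁅⁆ : ∀ {n} {H′ H : Graph n} {p r q s : Fin n} {U : Subset n}
  → EdgesWithin H′ H p r q s → IsVertexCover H U → p ∈ U
  → IsVertexCover H′ (U ∪ ⁅ s ⁆)
cover-∪⁅⁆ {s = s} within cover p∈U u v e with classify within u v e
... | inj₁ e′                          = Sum.map (p⊆p∪q ⁅ s ⁆) (p⊆p∪q ⁅ s ⁆) (cover u v e′)
... | inj₂ (inj₁ (inj₁ (refl , refl))) = inj₁ (p⊆p∪q ⁅ s ⁆ p∈U)
... | inj₂ (inj₁ (inj₂ (refl , refl))) = inj₂ (p⊆p∪q ⁅ s ⁆ p∈U)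
... | inj₂ (inj₂ (inj₁ (refl , refl))) = inj₂ (x∈p∪q⁺ (inj₂ (x∈⁅x⁆ s)))
... | inj₂ (inj₂ (inj₂ (refl , refl))) = inj₁ (x∈p∪q⁺ (inj₂ (x∈⁅x⁆ s)))

cover-extend : ∀ {n} {H′ H : Graph n} {p r q s : Fin n}
  → Edge H p q → EdgesWithin H′ H p r q s
  → (U : Subset n) → IsVertexCover H U
  → Σ (Subset n) λ V → IsVertexCover H′ V × ∣ V ∣ ≤ suc ∣ U ∣
cover-extend {p = p} {r} {q} {s} pq within U cover with cover p q pq
... | inj₁ p∈U = U ∪ ⁅ s ⁆ , cover-∪⁅⁆ within cover p∈U , ∣p∪⁅x⁆∣≤1+∣p∣ U s
... | inj₂ q∈U = U ∪ ⁅ r ⁆ , cover-∪⁅⁆ (EdgesWithin-swap within) cover q∈U , ∣p∪⁅x⁆∣≤1+∣p∣ U r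

coverNumber-edgesWithin-≤ : ∀ {n} {H′ H : Graph n} {p r q s : Fin n} {k k′ : ℕ}
  → Edge H p q → EdgesWithin H′ H p r q s
  → IsVertexCoverNumber H k → IsVertexCoverNumber H′ k′ → k′ ≤ suc k
coverNumber-edgesWithin-≤ pq within ((U , cover , refl) , _) (_ , minimal)
  with cover-extend pq within U cover
... | V , coverV , ∣V∣≤1+∣U∣ = ≤-trans (minimal V coverV) ∣V∣≤1+∣U∣

module _ {n} (G τG : Graph n) {a b c d : Fin n}
  (τG-adj : ∀ u v → adj τG u v ≡ switchAdj G a b c d u v) where

  adj≡does : ∀ u v → adj τG u v ≡ does (switchEdge? G a b c d u v)
  adj≡does u v = trans (τG-adj u v) (switchAdj≡does G a b c d u v)

  switch-edge : ∀ {u v} → SwitchEdge G a b c d u v → Edge τG u v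
  switch-edge {u} {v} e = trans (adj≡does u v) (dec-true (switchEdge? G a b c d u v) e)

  switch-edge⁻ : ∀ {u v} → Edge τG u v → SwitchEdge G a b c d u v
  switch-edge⁻ {u} {v} e = dec-true⁻ (switchEdge? G a b c d u v) (trans (sym (adj≡does u v)) e)

  ac∈τG : Edge τG a c
  ac∈τG = switch-edge (inj₂ (inj₁ (inj₁ (refl , refl))))

  τG⊆G+ac+bd : EdgesWithin τG G a c b d
  τG⊆G+ac+bd = edgesWithin λ u v e → map₁ proj₁ (switch-edge⁻ e)

  G⊆τG+ab+cd : EdgesWithin G τG a b c d
  G⊆τG+ab+cd = edgesWithin classifyG
    where
    classifyG : ∀ u v → Edge G u v → Edge τG u v ⊎ SamePair u v a b ⊎ SamePair u v c d
    classifyG u v e with samePair? u v a b | samePair? u v c d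
    ... | yes ab | _      = inj₂ (inj₁ ab)
    ... | no _   | yes cd = inj₂ (inj₂ cd)
    ... | no ¬ab | no ¬cd = inj₁ (switch-edge (inj₁ (e , ¬ab , ¬cd)))

mainTheorem11 : ∀ {n} (G : Graph n) (a b c d : Fin n)
    → Is2Switch G a b c d
    → (τG : Graph n)
    → (∀ u v → adj τG u v ≡ switchAdj G a b c d u v)
    → ∀ (k k′ : ℕ) → IsVertexCoverNumber G k → IsVertexCoverNumber τG k′
    → k ≤ suc k′ × k′ ≤ suc k
mainTheorem11 G a b c d (_ , _ , _ , _ , _ , _ , ab∈G , _) τG τG-adj _ _ νG ντG =
    coverNumber-edgesWithin-≤ (ac∈τG G τG τG-adj) (G⊆τG+ab+cd G τG τG-adj) ντG νG
  , coverNumber-edgesWithin-≤ ab∈G (τG⊆G+ac+bd G τG τG-adj) νG ντG
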